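{- Let $n\ge 7$ and let $\mathcal{M}$ be a Macbeath map of type $\{3,n\}$ with orientation-preserving automorphism group $\mathrm{PSL}_2(q)$. Let $\pm t$ be the trace of an automorphism (viewed as a matrix in $\mathrm{SL}_2(q)$ up to sign) rotating $\mathcal{M}$ by $2\pi/n$ around a vertex. Then $\mathcal{M}$ is inner regular if $3-t^2$ is a square in $\mathbb{F}_q$, and outer regular if $3-t^2$ is not a square in $\mathbb{F}_q$.
   Context: A map of type $\{3,n\}$ is a 2-cell embedding of a graph in a closed surface with all vertices of valency $n$ and all faces triangles. It is orientably regular if the surface is orientable and its group $\mathrm{Aut}^+\mathcal{M}$ of orientation-preserving automorphisms acts transitively on directed edges. For $n\ge 7$, a Macbeath map of type $\{3,n\}$ is an orientably regular map of type $\{3,n\}$ with $\mathrm{Aut}^+\mathcal{M}\cong G=\mathrm{PSL}_2(q)$, where $q$ is a prime power coprime to $n$. Such maps are fully regular (the full automorphism group acts transitively on flags). $\mathcal{M}$ is called inner regular if an orientation-reversing automorphism of $\mathcal{M}$ induces, by conjugation, an inner automorphism of $G$ (equivalently $\mathrm{Aut}\,\mathcal{M}\cong G\times\mathrm{C}_2$), and outer regular otherwise. Elements of $\mathrm{PSL}_2(q)$ are matrices of $\mathrm{SL}_2(q)$ modulo $\pm I$, so their traces are defined up to sign and $t^2$ is well defined. -}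

module Defs where

open import Data.Nat as ℕ using (ℕ; zero; suc)
open import Data.Fin using (Fin)
open import Data.List using (List; []; _∷_)
open import Data.List.Relation.Unary.All using (All)
open import Data.Product using (∃-syntax; _×_; _,_)
open import Data.Sum using (_⊎_)
open import Relation.Nullary using (¬_)
open import Relation.Binary.PropositionalEquality using (_≡_)
open import Function.Bundles using (_↔_)
open import Algebra.Structures using (IsCommutativeRing)

-- Finite fields F_q: a commutative ring (over propositional equality)
-- with 0 ≠ 1 and multiplicative inverses of nonzero elements, whose
-- carrier is in bijection with Fin q.  (So q is necessarily a prime
-- power, and every prime power occurs.)

record FiniteField (q : ℕ) : Set₁ where
  infixl 7 _*_
  infixl 6 _+_
  field
    Carrier : Set
    _+_ _*_ : Carrier → Carrier → Carrier
    -_      : Carrier → Carrier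
    0# 1#   : Carrier
    isCommutativeRing : IsCommutativeRing _≡_ _+_ _*_ -_ 0# 1#
    0≢1     : ¬ (0# ≡ 1#)
    *-inv   : ∀ x → ¬ (x ≡ 0#) → ∃[ y ] (y * x ≡ 1#)
    card    : Carrier ↔ Fin q

  infixl 6 _-_
  _-_ : Carrier → Carrier → Carrier
  x - y = x + (- y)

  IsSquare : Carrier → Set
  IsSquare x = ∃[ y ] (y * y ≡ x)

  3# : Carrier
  3# = 1# + 1# + 1#

-- 2×2 matrices over F, SL₂(F), and PSL₂(F) = SL₂(F)/{±I}.
-- PSL₂(F) is represented by matrices of determinant 1, compared with
-- the relation  M ∼ N  :⇔  M ≡ N or M ≡ -N.

module Matrices {q : ℕ} (F : FiniteField q) where
  open FiniteField F

  record Mat : Set where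
    constructor mat
    field
      a b c d : Carrier

  open Mat public

  det : Mat → Carrier
  det M = a M * d M - b M * c M

  tr : Mat → Carrier
  tr M = a M + d M

  InSL : Mat → Set
  InSL M = det M ≡ 1#

  I : Mat
  I = mat 1# 0# 0# 1#

  neg : Mat → Mat
  neg M = mat (- a M) (- b M) (- c M) (- d M)

  infixl 7 _·_
  _·_ : Mat → Mat → Mat
  M · N = mat (a M * a N + b M * c N) (a M * b N + b M * d N)
              (c M * a N + d M * c N) (c M * b N + d M * d N)

  -- adjugate; the inverse of a matrix of determinant 1
  inv : Mat → Mat
  inv M = mat (d M) (- b M) (- c M) (a M)

  _^_ : Mat → ℕ → Mat
  M ^ zero  = I
  M ^ suc k = M · (M ^ k)

  infix 4 _∼_
  _∼_ : Mat → Mat → Set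
  M ∼ N = M ≡ N ⊎ M ≡ neg N

  HasOrder : Mat → ℕ → Set
  HasOrder M m = (M ^ m ∼ I) × (∀ k → 0 ℕ.< k → k ℕ.< m → ¬ (M ^ k ∼ I))

  eval : List Mat → Mat
  eval []       = I
  eval (x ∷ xs) = x · eval xs

  Generate : Mat → Mat → Set
  Generate R S = ∀ M → InSL M →
    ∃[ w ] (All (λ x → x ≡ R ⊎ x ≡ S ⊎ x ≡ inv R ⊎ x ≡ inv S) w × (M ∼ eval w))

  record IsAutomorphism (f : Mat → Mat) : Set where
    field
      pres-SL  : ∀ M → InSL M → InSL (f M)
      pres-∼   : ∀ M N → InSL M → InSL N → M ∼ N → f M ∼ f N
      hom      : ∀ M N → InSL M → InSL N → f (M · N) ∼ f M · f N
      injective  : ∀ M N → InSL M → InSL N → f M ∼ f N → M ∼ N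
      surjective : ∀ N → InSL N → ∃[ M ] (InSL M × f M ∼ N)

  IsInner : (Mat → Mat) → Set
  IsInner f = ∃[ g ] (InSL g × (∀ M → InSL M → f M ∼ g · M · inv g))

  -- Orientably regular maps of type {3,n} with Aut⁺ M ≅ PSL₂(F),
  -- described (as usual) by a generating pair (R , S) of Aut⁺ M, where
  -- R is the rotation by 2π/n about a vertex (order n), S the half-turn
  -- about the midpoint of an incident edge (order 2), and R·S the
  -- rotation about an incident face (order 3).

  record IsMapOfType3 (n : ℕ) (R S : Mat) : Set where
    field
      R-SL   : InSL R
      S-SL   : InSL S
      R-ord  : HasOrder R n
      S-ord  : HasOrder S 2
      RS-ord : HasOrder (R · S) 3
      gen    : Generate R S

  -- An orientation-reversing automorphism (reflection) of the map acts
  -- on Aut⁺ M by conjugation as an automorphism inverting R and S.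
  InducedByReflection : Mat → Mat → (Mat → Mat) → Set
  InducedByReflection R S f =
    IsAutomorphism f × (f R ∼ inv R) × (f S ∼ inv S)

  FullyRegular : Mat → Mat → Set
  FullyRegular R S = ∃[ f ] InducedByReflection R S f

  InnerRegular : Mat → Mat → Set
  InnerRegular R S = ∃[ f ] (InducedByReflection R S f × IsInner f)

  OuterRegular : Mat → Mat → Set
  OuterRegular R S = FullyRegular R S × ¬ InnerRegular R S

-- Let t = tr R and X = RS - SR.  Cayley–Hamilton gives X R = R⁻¹ X and
-- X S = S⁻¹ X, so conjugation by X, rescaled by 1/det X, is an automorphism
-- of PSL₂(q) inverting R and S: the map is fully regular.  As S has order 2
-- and RS order 3, tr S = 0 and tr(RS)² = 1, whence det X = 3 - t²; this is
-- nonzero, since t² = 3 would give R⁶ = -I although R has order n ≥ 7.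
-- If det X = y², then X/y lies in SL₂(q) and the reflection is inner.
-- Conversely, if conjugation by some g ∈ SL₂(q) inverts R and S up to sign,
-- then g⁻¹X commutes up to sign with R and S, hence with all of SL₂(q), in
-- particular with both elementary unipotents; so g⁻¹X is scalar and
-- det X = det(g⁻¹X) is a square.

module Submission where

open import Defs
open import Data.Nat using (ℕ; _≤_)
open import Data.Nat.Coprimality using (Coprime)
open import Data.Product using (_×_)
open import Relation.Nullary using (¬_)

open import Level using (0ℓ)
open import Data.Nat as ℕ using (zero; suc; _<_; z<s; s<s)
open import Data.Integer as ℤ using (ℤ; +_; -[1+_])
import Data.Integer.Properties as ℤ
import Data.Nat.Properties as ℕ
open import Data.Sign as Sign using (Sign)
open import Data.Fin using (Fin; _↑ˡ_; _↑ʳ_; combine)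
open import Data.Fin.Patterns using (0F; 1F; 2F; 3F)
open import Data.Fin.Properties using (inj⇒≟)
open import Data.Vec using (Vec; []; _∷_; _++_; concat; map; tabulate)
open import Data.Vec.N-ary using (N-ary; N-ary-level; _$ⁿ_)
open import Data.List.Relation.Unary.All using (All; []; _∷_)
open import Data.Maybe using (just; nothing)
open import Data.Product using (∃-syntax; _,_; proj₁; proj₂)
open import Data.Sum as Sum using (_⊎_; inj₁; inj₂; reduce)
open import Data.Empty using (⊥-elim)
open import Function using (_∘_)
open import Relation.Nullary using (yes; no)
open import Relation.Nullary.Decidable using (decidable-stable)
open import Relation.Binary using (Setoid; DecidableEquality)
open import Relation.Binary.Definitions using (WeaklyDecidable)
open import Relation.Binary.PropositionalEquality
  using (_≡_; refl; sym; trans; cong; cong₂; subst; subst₂; module ≡-Reasoning)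
import Relation.Binary.Reasoning.Setoid as SetoidReasoning
open import Function.Properties.Inverse using (↔⇒↣)
open import Algebra.Bundles using (CommutativeRing)
open import Algebra.Solver.Ring.AlmostCommutativeRing
  using (_-Raw-AlmostCommutative⟶_; Induced-equivalence; fromCommutativeRing)

-- Normal forms are compared by refl, so coefficients must compute: an
-- abstract commutative ring is normalised over ℤ, mapped in by n ↦ n·1.
module IntegerCoefficientSolver {c ℓ} (R : CommutativeRing c ℓ) where
  open CommutativeRing R renaming (refl to ≈-refl; sym to ≈-sym; trans to ≈-trans)
  open import Algebra.Properties.Ring ring
    using (-‿involutive; -0#≈0#; -‿+-comm; -‿distribˡ-*; -‿distribʳ-*)
  open import Algebra.Properties.CommutativeSemigroup +-commutativeSemigroup
    using (interchange)
  open import Algebra.Properties.Semiring.Mult.TCOptimised semiring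
    using (×-homo-+; ×1-homo-*; 1+×) renaming (_×_ to _×ₙ_)
  open import Relation.Binary.Reasoning.Setoid setoid

  ⟦_⟧ℤ : ℤ → Carrier
  ⟦ + n ⟧ℤ      = n ×ₙ 1#
  ⟦ -[1+ n ] ⟧ℤ = - (suc n ×ₙ 1#)

  signed : Sign → Carrier → Carrier
  signed Sign.+ x = x
  signed Sign.- x = - x

  signed-cong : ∀ s {x y} → x ≈ y → signed s x ≈ signed s y
  signed-cong Sign.+ x≈y = x≈y
  signed-cong Sign.- x≈y = -‿cong x≈y

  signed-* : ∀ s t x y → signed (s Sign.* t) (x * y) ≈ signed s x * signed t y
  signed-* Sign.+ Sign.+ x y = ≈-refl
  signed-* Sign.+ Sign.- x y = -‿distribʳ-* x y
  signed-* Sign.- Sign.+ x y = -‿distribˡ-* x y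
  signed-* Sign.- Sign.- x y = begin
    x * y         ≈⟨ -‿involutive (x * y) ⟨
    - - (x * y)   ≈⟨ -‿cong (-‿distribˡ-* x y) ⟩
    - (- x * y)   ≈⟨ -‿distribʳ-* (- x) y ⟩
    - x * - y     ∎

  ⟦◃⟧ : ∀ s n → ⟦ s ℤ.◃ n ⟧ℤ ≈ signed s (n ×ₙ 1#)
  ⟦◃⟧ Sign.+ zero    = ≈-refl
  ⟦◃⟧ Sign.- zero    = ≈-sym -0#≈0#
  ⟦◃⟧ Sign.+ (suc n) = ≈-refl
  ⟦◃⟧ Sign.- (suc n) = ≈-refl

  ⟦⟧-signAbs : ∀ i → ⟦ i ⟧ℤ ≈ signed (ℤ.sign i) (ℤ.∣ i ∣ ×ₙ 1#)
  ⟦⟧-signAbs (+ n)    = ≈-refl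
  ⟦⟧-signAbs -[1+ n ] = ≈-refl

  *-homo : ∀ i j → ⟦ i ℤ.* j ⟧ℤ ≈ ⟦ i ⟧ℤ * ⟦ j ⟧ℤ
  *-homo i j = begin
    ⟦ i ℤ.* j ⟧ℤ                                 ≈⟨ ⟦◃⟧ (s Sign.* t) (m ℕ.* n) ⟩
    signed (s Sign.* t) ((m ℕ.* n) ×ₙ 1#)         ≈⟨ signed-cong (s Sign.* t) (×1-homo-* m n) ⟩
    signed (s Sign.* t) ((m ×ₙ 1#) * (n ×ₙ 1#))    ≈⟨ signed-* s t _ _ ⟩
    signed s (m ×ₙ 1#) * signed t (n ×ₙ 1#)        ≈⟨ *-cong (⟦⟧-signAbs i) (⟦⟧-signAbs j) ⟨
    ⟦ i ⟧ℤ * ⟦ j ⟧ℤ                              ∎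
    where
    s = ℤ.sign i
    t = ℤ.sign j
    m = ℤ.∣ i ∣
    n = ℤ.∣ j ∣

  ⊖-homo : ∀ m n → ⟦ m ℤ.⊖ n ⟧ℤ ≈ m ×ₙ 1# - n ×ₙ 1#
  ⊖-homo zero    zero    = ≈-sym (-‿inverseʳ 0#)
  ⊖-homo zero    (suc n) = ≈-sym (+-identityˡ _)
  ⊖-homo (suc m) zero    = ≈-sym (≈-trans (+-congˡ -0#≈0#) (+-identityʳ _))
  ⊖-homo (suc m) (suc n) = begin
    ⟦ suc m ℤ.⊖ suc n ⟧ℤ        ≡⟨ cong ⟦_⟧ℤ (ℤ.[1+m]⊖[1+n]≡m⊖n m n) ⟩
    ⟦ m ℤ.⊖ n ⟧ℤ                ≈⟨ ⊖-homo m n ⟩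
    x - y                     ≈⟨ +-identityˡ (x - y) ⟨
    0# + (x - y)              ≈⟨ +-congʳ (-‿inverseʳ 1#) ⟨
    (1# - 1#) + (x - y)       ≈⟨ interchange 1# (- 1#) x (- y) ⟩
    (1# + x) + (- 1# - y)     ≈⟨ +-cong (1+× m 1#) (≈-trans (-‿cong (1+× n 1#)) (≈-sym (-‿+-comm 1# y))) ⟨
    suc m ×ₙ 1# - suc n ×ₙ 1#   ∎
    where
    x = m ×ₙ 1#
    y = n ×ₙ 1#

  +-homo : ∀ i j → ⟦ i ℤ.+ j ⟧ℤ ≈ ⟦ i ⟧ℤ + ⟦ j ⟧ℤ
  +-homo -[1+ m ] -[1+ n ] = begin
    - (suc (suc (m ℕ.+ n)) ×ₙ 1#)   ≡⟨ cong (λ k → - (suc k ×ₙ 1#)) (ℕ.+-suc m n) ⟨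
    - ((suc m ℕ.+ suc n) ×ₙ 1#)     ≈⟨ -‿cong (×-homo-+ 1# (suc m) (suc n)) ⟩
    - (suc m ×ₙ 1# + suc n ×ₙ 1#)    ≈⟨ -‿+-comm _ _ ⟨
    - (suc m ×ₙ 1#) - suc n ×ₙ 1#    ∎
  +-homo -[1+ m ] (+ n)    = ≈-trans (⊖-homo n (suc m)) (+-comm _ _)
  +-homo (+ m)    -[1+ n ] = ⊖-homo m (suc n)
  +-homo (+ m)    (+ n)    = ×-homo-+ 1# m n

  -‿homo : ∀ i → ⟦ ℤ.- i ⟧ℤ ≈ - ⟦ i ⟧ℤ
  -‿homo -[1+ n ]  = ≈-sym (-‿involutive _)
  -‿homo (+ zero)  = ≈-sym -0#≈0#
  -‿homo (+ suc n) = ≈-refl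

  ℤ⟶R : ℤ.+-*-rawRing -Raw-AlmostCommutative⟶ fromCommutativeRing R
  ℤ⟶R = record
    { ⟦_⟧ = ⟦_⟧ℤ ; +-homo = +-homo ; *-homo = *-homo ; -‿homo = -‿homo
    ; 0-homo = ≈-refl ; 1-homo = ≈-refl }

  ℤ-coefficients≟ : WeaklyDecidable (Induced-equivalence ℤ⟶R)
  ℤ-coefficients≟ i j with i ℤ.≟ j
  ... | yes refl = just ≈-refl
  ... | no _     = nothing

  open import Algebra.Solver.Ring ℤ.+-*-rawRing (fromCommutativeRing R) ℤ⟶R ℤ-coefficients≟ public

module PSL₂ {q : ℕ} (F : FiniteField q) where
  open FiniteField F
  open Matrices F

  commutativeRing : CommutativeRing 0ℓ 0ℓ
  commutativeRing = record { isCommutativeRing = isCommutativeRing }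

  open CommutativeRing commutativeRing
    using (+-identityˡ; *-identityˡ; *-assoc; zeroʳ; ring)
  open import Algebra.Properties.Ring ring
    using (-0#≈0#; x[y-z]≈xy-xz; x∙y⁻¹≈ε⇒x≈y; x≈y⇒x∙y⁻¹≈ε; +-inverseˡ-unique; +-cancelˡ)
  open IntegerCoefficientSolver commutativeRing
    using (Polynomial; con; var; _:+_; _:*_; :-_; _:-_; ⟦_⟧; ⟦_⟧↓; prove; solve; _:=_)

  _≟_ : DecidableEquality Carrier
  _≟_ = inj⇒≟ (↔⇒↣ card)

  no-zero-divisors : ∀ {x y} → x * y ≡ 0# → x ≡ 0# ⊎ y ≡ 0#
  no-zero-divisors {x} {y} xy≡0 with x ≟ 0#
  ... | yes x≡0 = inj₁ x≡0
  ... | no  x≢0 = inj₂ (begin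
    y              ≡⟨ *-identityˡ y ⟨
    1# * y         ≡⟨ cong (_* y) x⁻¹x≡1 ⟨
    x⁻¹ * x * y    ≡⟨ *-assoc x⁻¹ x y ⟩
    x⁻¹ * (x * y)  ≡⟨ cong (x⁻¹ *_) xy≡0 ⟩
    x⁻¹ * 0#       ≡⟨ zeroʳ x⁻¹ ⟩
    0#             ∎)
    where
    open ≡-Reasoning
    x⁻¹ = proj₁ (*-inv x x≢0)
    x⁻¹x≡1 = proj₂ (*-inv x x≢0)

  nonzero-*≡0⇒≡0 : ∀ {x y} → ¬ x ≡ 0# → x * y ≡ 0# → y ≡ 0#
  nonzero-*≡0⇒≡0 x≢0 xy≡0 with no-zero-divisors xy≡0
  ... | inj₁ x≡0 = ⊥-elim (x≢0 x≡0)
  ... | inj₂ y≡0 = y≡0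

  square≡0⇒≡0 : ∀ {x} → x * x ≡ 0# → x ≡ 0#
  square≡0⇒≡0 = reduce ∘ no-zero-divisors

  *-cancelˡ : ∀ {k x y} → ¬ k ≡ 0# → k * x ≡ k * y → x ≡ y
  *-cancelˡ {k} {x} {y} k≢0 kx≡ky =
    x∙y⁻¹≈ε⇒x≈y x y (nonzero-*≡0⇒≡0 k≢0 (trans (x[y-z]≈xy-xz k x y) (x≈y⇒x∙y⁻¹≈ε kx≡ky)))

  square≡1⇒≡±1 : ∀ {x} → x * x ≡ 1# → x ≡ 1# ⊎ x ≡ - 1#
  square≡1⇒≡±1 {x} xx≡1 = Sum.map (x∙y⁻¹≈ε⇒x≈y x 1#) (+-inverseˡ-unique x 1#)
    (no-zero-divisors (trans factorisation (x≈y⇒x∙y⁻¹≈ε xx≡1)))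
    where
    factorisation : (x - 1#) * (x + 1#) ≡ x * x - 1#
    factorisation = solve 1 (λ x → (x :- con (+ 1)) :* (x :+ con (+ 1)) := x :* x :- con (+ 1)) refl x

  infixr 8 _⊙_
  infixl 6 _⊕_ _⊖_

  _⊙_ : Carrier → Mat → Mat
  k ⊙ M = mat (k * a M) (k * b M) (k * c M) (k * d M)

  _⊕_ _⊖_ : Mat → Mat → Mat
  M ⊕ N = mat (a M + a N) (b M + b N) (c M + c N) (d M + d N)
  M ⊖ N = mat (a M - a N) (b M - b N) (c M - c N) (d M - d N)

  conjugate : Mat → Carrier → Mat → Mat
  conjugate h κ M = κ ⊙ (h · M · inv h)

  bracket : Mat → Mat → Mat
  bracket R S = R · S ⊖ S · R

  transpose : Mat → Mat
  transpose M = mat (a M) (c M) (b M) (d M)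

  O U L : Mat
  O = mat 0# 0# 0# 0#
  U = mat 1# 1# 0# 1#
  L = mat 1# 0# 1# 1#

  mat-cong : ∀ {x y z w x′ y′ z′ w′} → x ≡ x′ → y ≡ y′ → z ≡ z′ → w ≡ w′ →
             mat x y z w ≡ mat x′ y′ z′ w′
  mat-cong refl refl refl refl = refl

  -- Matrices over the solver's polynomials, with the operations above
  -- transcribed verbatim: evaluating a polynomial matrix then computes
  -- definitionally to the corresponding matrix expression, so a matrix
  -- identity reduces to four ring identities between its entries.
  record Matₚ (n : ℕ) : Set where
    constructor matₚ
    field aₚ bₚ cₚ dₚ : Polynomial n

  open Matₚ

  module _ {n : ℕ} where
    infixl 7 _·ₚ_
    infixr 8 _⊙ₚ_
    infixl 6 _⊕ₚ_ _⊖ₚ_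

    _·ₚ_ _⊕ₚ_ _⊖ₚ_ : Matₚ n → Matₚ n → Matₚ n
    M ·ₚ N = matₚ (aₚ M :* aₚ N :+ bₚ M :* cₚ N) (aₚ M :* bₚ N :+ bₚ M :* dₚ N)
                  (cₚ M :* aₚ N :+ dₚ M :* cₚ N) (cₚ M :* bₚ N :+ dₚ M :* dₚ N)
    M ⊕ₚ N = matₚ (aₚ M :+ aₚ N) (bₚ M :+ bₚ N) (cₚ M :+ cₚ N) (dₚ M :+ dₚ N)
    M ⊖ₚ N = matₚ (aₚ M :- aₚ N) (bₚ M :- bₚ N) (cₚ M :- cₚ N) (dₚ M :- dₚ N)

    _⊙ₚ_ : Polynomial n → Matₚ n → Matₚ n
    k ⊙ₚ M = matₚ (k :* aₚ M) (k :* bₚ M) (k :* cₚ M) (k :* dₚ M)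

    detₚ trₚ : Matₚ n → Polynomial n
    detₚ M = aₚ M :* dₚ M :- bₚ M :* cₚ M
    trₚ M = aₚ M :+ dₚ M

    invₚ negₚ : Matₚ n → Matₚ n
    invₚ M = matₚ (dₚ M) (:- bₚ M) (:- cₚ M) (aₚ M)
    negₚ M = matₚ (:- aₚ M) (:- bₚ M) (:- cₚ M) (:- dₚ M)

    Iₚ Oₚ Uₚ Lₚ : Matₚ n
    Iₚ = matₚ (con (+ 1)) (con (+ 0)) (con (+ 0)) (con (+ 1))
    Oₚ = matₚ (con (+ 0)) (con (+ 0)) (con (+ 0)) (con (+ 0))
    Uₚ = matₚ (con (+ 1)) (con (+ 1)) (con (+ 0)) (con (+ 1))
    Lₚ = matₚ (con (+ 1)) (con (+ 0)) (con (+ 1)) (con (+ 1))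

    _^ₚ_ : Matₚ n → ℕ → Matₚ n
    M ^ₚ zero  = Iₚ
    M ^ₚ suc k = M ·ₚ (M ^ₚ k)

    conjugateₚ : Matₚ n → Polynomial n → Matₚ n → Matₚ n
    conjugateₚ H x M = x ⊙ₚ (H ·ₚ M ·ₚ invₚ H)

    bracketₚ : Matₚ n → Matₚ n → Matₚ n
    bracketₚ M N = M ·ₚ N ⊖ₚ N ·ₚ M

    transposeₚ : Matₚ n → Matₚ n
    transposeₚ M = matₚ (aₚ M) (cₚ M) (bₚ M) (dₚ M)

  ⟦_⟧ₘ ⟦_⟧↓ₘ : ∀ {n} → Matₚ n → Vec Carrier n → Mat
  ⟦ M ⟧ₘ  ρ = mat (⟦ aₚ M ⟧ ρ) (⟦ bₚ M ⟧ ρ) (⟦ cₚ M ⟧ ρ) (⟦ dₚ M ⟧ ρ)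
  ⟦ M ⟧↓ₘ ρ = mat (⟦ aₚ M ⟧↓ ρ) (⟦ bₚ M ⟧↓ ρ) (⟦ cₚ M ⟧↓ ρ) (⟦ dₚ M ⟧↓ ρ)

  proveₘ : ∀ {n} (ρ : Vec Carrier n) (P Q : Matₚ n) → ⟦ P ⟧↓ₘ ρ ≡ ⟦ Q ⟧↓ₘ ρ → ⟦ P ⟧ₘ ρ ≡ ⟦ Q ⟧ₘ ρ
  proveₘ ρ P Q eq = mat-cong (prove ρ (aₚ P) (aₚ Q) (cong a eq)) (prove ρ (bₚ P) (bₚ Q) (cong b eq))
                             (prove ρ (cₚ P) (cₚ Q) (cong c eq)) (prove ρ (dₚ P) (dₚ Q) (cong d eq))

  -- An identity in s scalars and k matrices uses s + 4k variables:
  -- first the scalars, then the entries of the matrices.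
  module _ {s k : ℕ} where
    scalarVar : Fin s → Polynomial (s ℕ.+ k ℕ.* 4)
    scalarVar i = var (i ↑ˡ k ℕ.* 4)

    matrixVar : Fin k → Matₚ (s ℕ.+ k ℕ.* 4)
    matrixVar i = matₚ (entry 0F) (entry 1F) (entry 2F) (entry 3F)
      where entry = λ j → var (s ↑ʳ combine i j)

    environment : Vec Carrier s → Vec Mat k → Vec Carrier (s ℕ.+ k ℕ.* 4)
    environment xs Ms = xs ++ concat (map (λ M → a M ∷ b M ∷ c M ∷ d M ∷ []) Ms)

  Equation : (s k : ℕ) → (ℕ → Set) → Set (N-ary-level 0ℓ (N-ary-level 0ℓ 0ℓ k) s)
  Equation s k A = N-ary s (Polynomial n) (N-ary k (Matₚ n) (A n × A n))
    where n = s ℕ.+ k ℕ.* 4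

  sides : ∀ s k {A} → Equation s k A → A (s ℕ.+ k ℕ.* 4) × A (s ℕ.+ k ℕ.* 4)
  sides s k f = (f $ⁿ tabulate (scalarVar {s} {k})) $ⁿ tabulate (matrixVar {s} {k})

  scalar-identity : ∀ s k (f : Equation s k Polynomial) (xs : Vec Carrier s) (Ms : Vec Mat k) →
    let ρ = environment xs Ms ; p = proj₁ (sides s k {Polynomial} f) ; p′ = proj₂ (sides s k {Polynomial} f) in
    ⟦ p ⟧↓ ρ ≡ ⟦ p′ ⟧↓ ρ → ⟦ p ⟧ ρ ≡ ⟦ p′ ⟧ ρ
  scalar-identity s k f xs Ms = prove (environment xs Ms) (proj₁ (sides s k {Polynomial} f)) (proj₂ (sides s k {Polynomial} f))

  matrix-identity : ∀ s k (f : Equation s k Matₚ) (xs : Vec Carrier s) (Ms : Vec Mat k) →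
    let ρ = environment xs Ms ; P = proj₁ (sides s k {Matₚ} f) ; P′ = proj₂ (sides s k {Matₚ} f) in
    ⟦ P ⟧↓ₘ ρ ≡ ⟦ P′ ⟧↓ₘ ρ → ⟦ P ⟧ₘ ρ ≡ ⟦ P′ ⟧ₘ ρ
  matrix-identity s k f xs Ms = proveₘ (environment xs Ms) (proj₁ (sides s k {Matₚ} f)) (proj₂ (sides s k {Matₚ} f))

  ·-assoc : ∀ M N P → M · N · P ≡ M · (N · P)
  ·-assoc M N P = matrix-identity 0 3 (λ X Y Z → X ·ₚ Y ·ₚ Z , X ·ₚ (Y ·ₚ Z)) [] (M ∷ N ∷ P ∷ []) refl

  ·-identityʳ : ∀ M → M · I ≡ M
  ·-identityʳ M = matrix-identity 0 1 (λ X → X ·ₚ Iₚ , X) [] (M ∷ []) refl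

  I-central : ∀ M → M · I ≡ I · M
  I-central M = matrix-identity 0 1 (λ X → X ·ₚ Iₚ , Iₚ ·ₚ X) [] (M ∷ []) refl

  ⊙-identity : ∀ M → 1# ⊙ M ≡ M
  ⊙-identity M = matrix-identity 0 1 (λ X → con (+ 1) ⊙ₚ X , X) [] (M ∷ []) refl

  ⊙-·ˡ : ∀ k M N → (k ⊙ M) · N ≡ k ⊙ (M · N)
  ⊙-·ˡ k M N = matrix-identity 1 2 (λ x X Y → (x ⊙ₚ X) ·ₚ Y , x ⊙ₚ (X ·ₚ Y)) (k ∷ []) (M ∷ N ∷ []) refl

  ⊙-·ʳ : ∀ k M N → M · (k ⊙ N) ≡ k ⊙ (M · N)
  ⊙-·ʳ k M N = matrix-identity 1 2 (λ x X Y → X ·ₚ (x ⊙ₚ Y) , x ⊙ₚ (X ·ₚ Y)) (k ∷ []) (M ∷ N ∷ []) refl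

  neg-involutive : ∀ M → neg (neg M) ≡ M
  neg-involutive M = matrix-identity 0 1 (λ X → negₚ (negₚ X) , X) [] (M ∷ []) refl

  ·-neg : ∀ M N → M · neg N ≡ neg (M · N)
  ·-neg M N = matrix-identity 0 2 (λ X Y → X ·ₚ negₚ Y , negₚ (X ·ₚ Y)) [] (M ∷ N ∷ []) refl

  neg-· : ∀ M N → neg M · N ≡ neg (M · N)
  neg-· M N = matrix-identity 0 2 (λ X Y → negₚ X ·ₚ Y , negₚ (X ·ₚ Y)) [] (M ∷ N ∷ []) refl

  ⊖-self : ∀ M → M ⊖ M ≡ O
  ⊖-self M = matrix-identity 0 1 (λ X → X ⊖ₚ X , Oₚ) [] (M ∷ []) refl

  neg-⊕-self : ∀ M → neg M ⊕ M ≡ O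
  neg-⊕-self M = matrix-identity 0 1 (λ X → negₚ X ⊕ₚ X , Oₚ) [] (M ∷ []) refl

  det-· : ∀ M N → det (M · N) ≡ det M * det N
  det-· M N = scalar-identity 0 2 (λ X Y → detₚ (X ·ₚ Y) , detₚ X :* detₚ Y) [] (M ∷ N ∷ []) refl

  det-inv : ∀ M → det (inv M) ≡ det M
  det-inv M = scalar-identity 0 1 (λ X → detₚ (invₚ X) , detₚ X) [] (M ∷ []) refl

  det-⊙ : ∀ k M → det (k ⊙ M) ≡ k * k * det M
  det-⊙ k M = scalar-identity 1 1 (λ x X → detₚ (x ⊙ₚ X) , x :* x :* detₚ X) (k ∷ []) (M ∷ []) refl

  det-U : det U ≡ 1#
  det-U = scalar-identity 0 0 (detₚ Uₚ , con (+ 1)) [] [] refl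

  det-L : det L ≡ 1#
  det-L = scalar-identity 0 0 (detₚ Lₚ , con (+ 1)) [] [] refl

  ⊙-unit : ∀ {u} M → u ≡ 1# → u ⊙ M ≡ M
  ⊙-unit M refl = ⊙-identity M

  ∼-refl : ∀ {M} → M ∼ M
  ∼-refl = inj₁ refl

  ∼-neg : ∀ M → M ∼ neg M
  ∼-neg M = inj₂ (sym (neg-involutive M))

  neg-∼ : ∀ M → neg M ∼ M
  neg-∼ M = inj₂ refl

  ∼-sym : ∀ {M N} → M ∼ N → N ∼ M
  ∼-sym (inj₁ refl) = ∼-refl
  ∼-sym (inj₂ refl) = ∼-neg _

  ∼-trans : ∀ {M N P} → M ∼ N → N ∼ P → M ∼ P
  ∼-trans (inj₁ refl) N∼P         = N∼P
  ∼-trans (inj₂ refl) (inj₁ refl) = inj₂ refl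
  ∼-trans (inj₂ refl) (inj₂ refl) = inj₁ (neg-involutive _)

  ∼-setoid : Setoid 0ℓ 0ℓ
  ∼-setoid = record
    { Carrier = Mat ; _≈_ = _∼_
    ; isEquivalence = record { refl = ∼-refl ; sym = ∼-sym ; trans = ∼-trans } }

  module ∼-Reasoning = SetoidReasoning ∼-setoid

  ∼-·ˡ : ∀ P {M N} → M ∼ N → P · M ∼ P · N
  ∼-·ˡ P (inj₁ refl) = ∼-refl
  ∼-·ˡ P (inj₂ refl) = inj₂ (·-neg P _)

  ∼-·ʳ : ∀ P {M N} → M ∼ N → M · P ∼ N · P
  ∼-·ʳ P (inj₁ refl) = ∼-refl
  ∼-·ʳ P (inj₂ refl) = inj₂ (neg-· _ P)

  neg-cancel : ∀ {M N} → neg M ∼ neg N → M ∼ N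
  neg-cancel {M} {N} e = ∼-trans (∼-neg M) (∼-trans e (neg-∼ N))

  IsScalar : Mat → Set
  IsScalar M = b M ≡ 0# × c M ≡ 0# × a M ≡ d M

  det-IsScalar : ∀ {M} → IsScalar M → det M ≡ a M * a M
  det-IsScalar {M} (b≡0 , c≡0 , a≡d) = begin
    a M * d M - b M * c M  ≡⟨ cong₂ (λ x y → a M * x - y * c M) (sym a≡d) b≡0 ⟩
    a M * a M - 0# * c M   ≡⟨ solve 2 (λ x y → x :* x :- con (+ 0) :* y := x :* x) refl (a M) (c M) ⟩
    a M * a M              ∎
    where open ≡-Reasoning

  ∼I⇒IsScalar : ∀ {M} → M ∼ I → IsScalar M
  ∼I⇒IsScalar (inj₁ refl) = refl , refl , refl
  ∼I⇒IsScalar (inj₂ refl) = -0#≈0# , -0#≈0# , refl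

  IsScalar⇒∼I : ∀ {M} → det M ≡ 1# → IsScalar M → M ∼ I
  IsScalar⇒∼I {M} det≡1 s@(b≡0 , c≡0 , a≡d) with square≡1⇒≡±1 (trans (sym (det-IsScalar s)) det≡1)
  ... | inj₁ a≡1  = inj₁ (mat-cong a≡1 b≡0 c≡0 (trans (sym a≡d) a≡1))
  ... | inj₂ a≡-1 = inj₂ (mat-cong a≡-1 (trans b≡0 (sym -0#≈0#)) (trans c≡0 (sym -0#≈0#)) (trans (sym a≡d) a≡-1))

  IsScalar-⊕ : ∀ {α β X} → ¬ β ≡ 0# → IsScalar (α ⊙ I ⊕ β ⊙ X) → IsScalar X
  IsScalar-⊕ {α} {β} {X} β≢0 (b≡0 , c≡0 , a≡d) =
    nonzero-*≡0⇒≡0 β≢0 (trans (sym (α*0+y≡y _)) b≡0) ,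
    nonzero-*≡0⇒≡0 β≢0 (trans (sym (α*0+y≡y _)) c≡0) ,
    *-cancelˡ β≢0 (+-cancelˡ (α * 1#) _ _ a≡d)
    where
    α*0+y≡y : ∀ y → α * 0# + y ≡ y
    α*0+y≡y y = trans (cong (_+ y) (zeroʳ α)) (+-identityˡ y)

  ⊕-∼I⇒∼I : ∀ {α β X} → det X ≡ 1# → ¬ β ≡ 0# → α ⊙ I ⊕ β ⊙ X ∼ I → X ∼ I
  ⊕-∼I⇒∼I det≡1 β≢0 = IsScalar⇒∼I det≡1 ∘ IsScalar-⊕ β≢0 ∘ ∼I⇒IsScalar

  -- Orders via Cayley–Hamilton

  square-Cayley–Hamilton : ∀ X → X ^ 2 ≡ (- det X) ⊙ I ⊕ tr X ⊙ X
  square-Cayley–Hamilton X =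
    matrix-identity 0 1 (λ Y → Y ^ₚ 2 , (:- detₚ Y) ⊙ₚ Iₚ ⊕ₚ trₚ Y ⊙ₚ Y) [] (X ∷ []) refl

  cube-Cayley–Hamilton : ∀ X → X ^ 3 ≡ (- (det X * tr X)) ⊙ I ⊕ (tr X * tr X - det X) ⊙ X
  cube-Cayley–Hamilton X = matrix-identity 0 1
    (λ Y → Y ^ₚ 3 , (:- (detₚ Y :* trₚ Y)) ⊙ₚ Iₚ ⊕ₚ (trₚ Y :* trₚ Y :- detₚ Y) ⊙ₚ Y) [] (X ∷ []) refl

  tr-cube : ∀ X → tr (X ^ 3) ≡ tr X * (tr X * tr X - 3# * det X)
  tr-cube X = scalar-identity 0 1
    (λ Y → trₚ (Y ^ₚ 3) , trₚ Y :* (trₚ Y :* trₚ Y :- con (+ 3) :* detₚ Y)) [] (X ∷ []) refl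

  det-cube : ∀ X → det (X ^ 3) ≡ det X * det X * det X
  det-cube X = scalar-identity 0 1 (λ Y → detₚ (Y ^ₚ 3) , detₚ Y :* detₚ Y :* detₚ Y) [] (X ∷ []) refl

  ^6≡^3^2 : ∀ X → X ^ 6 ≡ (X ^ 3) ^ 2
  ^6≡^3^2 X = matrix-identity 0 1 (λ Y → Y ^ₚ 6 , (Y ^ₚ 3) ^ₚ 2) [] (X ∷ []) refl

  -I≡neg-I : ∀ X → (- 1#) ⊙ I ⊕ 0# ⊙ X ≡ neg I
  -I≡neg-I X = matrix-identity 0 1 (λ Y → (:- con (+ 1)) ⊙ₚ Iₚ ⊕ₚ con (+ 0) ⊙ₚ Y , negₚ Iₚ) [] (X ∷ []) refl

  order>1⇒≁I : ∀ {X m} → HasOrder X m → 1 < m → ¬ X ∼ I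
  order>1⇒≁I {X} (_ , minimal) 1<m X∼I = minimal 1 z<s 1<m (subst (_∼ I) (sym (·-identityʳ X)) X∼I)

  order-2⇒traceless : ∀ {X} → det X ≡ 1# → HasOrder X 2 → tr X ≡ 0#
  order-2⇒traceless {X} det≡1 order@(X²∼I , _) = decidable-stable (tr X ≟ 0#) λ t≢0 →
    order>1⇒≁I order (s<s z<s) (⊕-∼I⇒∼I det≡1 t≢0 (subst (_∼ I) X²≡ X²∼I))
    where
    X²≡ : X ^ 2 ≡ (- 1#) ⊙ I ⊕ tr X ⊙ X
    X²≡ = trans (square-Cayley–Hamilton X) (cong (λ δ → (- δ) ⊙ I ⊕ tr X ⊙ X) det≡1)

  order-3⇒trace²≡1 : ∀ {X} → det X ≡ 1# → HasOrder X 3 → tr X * tr X ≡ 1#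
  order-3⇒trace²≡1 {X} det≡1 order@(X³∼I , _) = x∙y⁻¹≈ε⇒x≈y _ _ (decidable-stable (β ≟ 0#) λ β≢0 →
    order>1⇒≁I order (s<s z<s) (⊕-∼I⇒∼I det≡1 β≢0 (subst (_∼ I) X³≡ X³∼I)))
    where
    t = tr X
    β = t * t - 1#
    X³≡ : X ^ 3 ≡ (- (1# * t)) ⊙ I ⊕ β ⊙ X
    X³≡ = trans (cube-Cayley–Hamilton X) (cong (λ δ → (- (δ * t)) ⊙ I ⊕ (t * t - δ) ⊙ X) det≡1)

  trace²≡3⇒^6∼I : ∀ {X} → det X ≡ 1# → tr X * tr X ≡ 3# → X ^ 6 ∼ I
  trace²≡3⇒^6∼I {X} det≡1 t²≡3 = inj₂ (begin
    X ^ 6                                          ≡⟨ ^6≡^3^2 X ⟩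
    (X ^ 3) ^ 2                                    ≡⟨ square-Cayley–Hamilton (X ^ 3) ⟩
    (- det (X ^ 3)) ⊙ I ⊕ tr (X ^ 3) ⊙ X ^ 3       ≡⟨ cong₂ (λ δ τ → (- δ) ⊙ I ⊕ τ ⊙ X ^ 3) det-X³≡1 tr-X³≡0 ⟩
    (- 1#) ⊙ I ⊕ 0# ⊙ X ^ 3                        ≡⟨ -I≡neg-I (X ^ 3) ⟩
    neg I                                          ∎)
    where
    open ≡-Reasoning
    det-X³≡1 : det (X ^ 3) ≡ 1#
    det-X³≡1 = begin
      det (X ^ 3)                   ≡⟨ det-cube X ⟩
      det X * det X * det X         ≡⟨ cong (λ δ → δ * δ * δ) det≡1 ⟩
      1# * 1# * 1#                  ≡⟨ solve 0 (con (+ 1) :* con (+ 1) :* con (+ 1) := con (+ 1)) refl ⟩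
      1#                            ∎
    tr-X³≡0 : tr (X ^ 3) ≡ 0#
    tr-X³≡0 = begin
      tr (X ^ 3)                    ≡⟨ tr-cube X ⟩
      tr X * (tr X * tr X - 3# * det X) ≡⟨ cong₂ (λ τ δ → tr X * (τ - 3# * δ)) t²≡3 det≡1 ⟩
      tr X * (3# - 3# * 1#)         ≡⟨ solve 1 (λ t → t :* (con (+ 3) :- con (+ 3) :* con (+ 1)) := con (+ 0)) refl (tr X) ⟩
      0#                            ∎

  det-conjugate : ∀ h κ M → det (conjugate h κ M) ≡ κ * det h * (κ * det h) * det M
  det-conjugate h κ M = scalar-identity 1 2
    (λ x H X → detₚ (conjugateₚ H x X) , x :* detₚ H :* (x :* detₚ H) :* detₚ X) (κ ∷ []) (h ∷ M ∷ []) refl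

  conjugate-neg : ∀ h κ M → conjugate h κ (neg M) ≡ neg (conjugate h κ M)
  conjugate-neg h κ M = matrix-identity 1 2
    (λ x H X → conjugateₚ H x (negₚ X) , negₚ (conjugateₚ H x X)) (κ ∷ []) (h ∷ M ∷ []) refl

  conjugate-· : ∀ h κ M N → conjugate h κ M · conjugate h κ N ≡ (κ * det h) ⊙ conjugate h κ (M · N)
  conjugate-· h κ M N = matrix-identity 1 3
    (λ x H X Y → conjugateₚ H x X ·ₚ conjugateₚ H x Y , (x :* detₚ H) ⊙ₚ conjugateₚ H x (X ·ₚ Y))
    (κ ∷ []) (h ∷ M ∷ N ∷ []) refl

  conjugate-inv-conjugate : ∀ h κ M → conjugate (inv h) κ (conjugate h κ M) ≡ (κ * det h * (κ * det h)) ⊙ M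
  conjugate-inv-conjugate h κ M = matrix-identity 1 2
    (λ x H X → conjugateₚ (invₚ H) x (conjugateₚ H x X) , (x :* detₚ H :* (x :* detₚ H)) ⊙ₚ X)
    (κ ∷ []) (h ∷ M ∷ []) refl

  conjugate-conjugate-inv : ∀ h κ M → conjugate h κ (conjugate (inv h) κ M) ≡ (κ * det h * (κ * det h)) ⊙ M
  conjugate-conjugate-inv h κ M = matrix-identity 1 2
    (λ x H X → conjugateₚ H x (conjugateₚ (invₚ H) x X) , (x :* detₚ H :* (x :* detₚ H)) ⊙ₚ X)
    (κ ∷ []) (h ∷ M ∷ []) refl

  conjugate-cong : ∀ h κ {M N} → M ∼ N → conjugate h κ M ∼ conjugate h κ N
  conjugate-cong h κ (inj₁ refl) = ∼-refl
  conjugate-cong h κ (inj₂ refl) = inj₂ (conjugate-neg h κ _)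

  conjugate-preserves-SL : ∀ {h κ} → κ * det h ≡ 1# → ∀ M → InSL M → InSL (conjugate h κ M)
  conjugate-preserves-SL {h} {κ} κh≡1 M M∈SL = begin
    det (conjugate h κ M)            ≡⟨ det-conjugate h κ M ⟩
    κ * det h * (κ * det h) * det M  ≡⟨ cong₂ (λ u δ → u * u * δ) κh≡1 M∈SL ⟩
    1# * 1# * 1#                     ≡⟨ solve 0 (con (+ 1) :* con (+ 1) :* con (+ 1) := con (+ 1)) refl ⟩
    1#                               ∎
    where open ≡-Reasoning

  module _ {h κ} (κh≡1 : κ * det h ≡ 1#) where
    private
      κh²≡1 : κ * det h * (κ * det h) ≡ 1#
      κh²≡1 = trans (cong₂ _*_ κh≡1 κh≡1) (*-identityˡ 1#)

    conjugate-injective : ∀ {M N} → conjugate h κ M ∼ conjugate h κ N → M ∼ N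
    conjugate-injective {M} {N} fM∼fN = begin
      M                                       ≡⟨ trans (conjugate-inv-conjugate h κ M) (⊙-unit M κh²≡1) ⟨
      conjugate (inv h) κ (conjugate h κ M)   ≈⟨ conjugate-cong (inv h) κ fM∼fN ⟩
      conjugate (inv h) κ (conjugate h κ N)   ≡⟨ trans (conjugate-inv-conjugate h κ N) (⊙-unit N κh²≡1) ⟩
      N                                       ∎
      where open ∼-Reasoning

    conjugate-surjective : ∀ N → InSL N → ∃[ M ] (InSL M × conjugate h κ M ∼ N)
    conjugate-surjective N N∈SL =
      conjugate (inv h) κ N ,
      conjugate-preserves-SL (trans (cong (κ *_) (det-inv h)) κh≡1) N N∈SL ,
      inj₁ (trans (conjugate-conjugate-inv h κ N) (⊙-unit N κh²≡1))

    conjugate-isAutomorphism : IsAutomorphism (conjugate h κ)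
    conjugate-isAutomorphism = record
      { pres-SL    = conjugate-preserves-SL κh≡1
      ; pres-∼     = λ _ _ _ _ → conjugate-cong h κ
      ; hom        = λ M N _ _ → inj₁ (sym (trans (conjugate-· h κ M N) (⊙-unit _ κh≡1)))
      ; injective  = λ _ _ _ _ → conjugate-injective
      ; surjective = conjugate-surjective
      }

  Inverts : Mat → Mat → Set
  Inverts h Y = h · Y ≡ inv Y · h

  Inverts-⊙ : ∀ l {h Y} → Inverts h Y → Inverts (l ⊙ h) Y
  Inverts-⊙ l {h} {Y} hY = begin
    (l ⊙ h) · Y     ≡⟨ ⊙-·ˡ l h Y ⟩
    l ⊙ (h · Y)     ≡⟨ cong (l ⊙_) hY ⟩
    l ⊙ (inv Y · h) ≡⟨ ⊙-·ʳ l (inv Y) h ⟨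
    inv Y · (l ⊙ h) ∎
    where open ≡-Reasoning

  conjugate-inverted : ∀ {h κ Y} → κ * det h ≡ 1# → Inverts h Y → conjugate h κ Y ≡ inv Y
  conjugate-inverted {h} {κ} {Y} κh≡1 hY = begin
    κ ⊙ (h · Y · inv h)      ≡⟨ cong (λ Z → κ ⊙ (Z · inv h)) hY ⟩
    κ ⊙ (inv Y · h · inv h)  ≡⟨ matrix-identity 1 2 (λ x H X → x ⊙ₚ (invₚ X ·ₚ H ·ₚ invₚ H) , (x :* detₚ H) ⊙ₚ invₚ X)
                                  (κ ∷ []) (h ∷ Y ∷ []) refl ⟩
    (κ * det h) ⊙ inv Y      ≡⟨ ⊙-unit (inv Y) κh≡1 ⟩
    inv Y                    ∎
    where open ≡-Reasoning

  reflection : ∀ {h κ R S} → κ * det h ≡ 1# → Inverts h R → Inverts h S →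
               InducedByReflection R S (conjugate h κ)
  reflection κh≡1 hR hS =
    conjugate-isAutomorphism κh≡1 , inj₁ (conjugate-inverted κh≡1 hR) , inj₁ (conjugate-inverted κh≡1 hS)

  infix 4 _⇄_
  _⇄_ : Mat → Mat → Set
  K ⇄ M = K · M ∼ M · K

  ⇄-I : ∀ K → K ⇄ I
  ⇄-I K = inj₁ (I-central K)

  ⇄-· : ∀ {K M N} → K ⇄ M → K ⇄ N → K ⇄ M · N
  ⇄-· {K} {M} {N} KM KN = begin
    K · (M · N)  ≡⟨ ·-assoc K M N ⟨
    K · M · N    ≈⟨ ∼-·ʳ N KM ⟩
    M · K · N    ≡⟨ ·-assoc M K N ⟩
    M · (K · N)  ≈⟨ ∼-·ˡ M KN ⟩
    M · (N · K)  ≡⟨ ·-assoc M N K ⟨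
    M · N · K    ∎
    where open ∼-Reasoning

  ⇄-inv : ∀ {K M} → det M ≡ 1# → K ⇄ M → K ⇄ inv M
  ⇄-inv {K} {M} det≡1 KM = ∼-sym (begin
    inv M · K                    ≡⟨ ⊙-unit (inv M · K) det≡1 ⟨
    det M ⊙ (inv M · K)          ≡⟨ matrix-identity 0 2 (λ Y X → invₚ X ·ₚ (Y ·ₚ X) ·ₚ invₚ X , detₚ X ⊙ₚ (invₚ X ·ₚ Y))
                                      [] (K ∷ M ∷ []) refl ⟨
    inv M · (K · M) · inv M      ≈⟨ ∼-·ʳ (inv M) (∼-·ˡ (inv M) KM) ⟩
    inv M · (M · K) · inv M      ≡⟨ matrix-identity 0 2 (λ Y X → invₚ X ·ₚ (X ·ₚ Y) ·ₚ invₚ X , detₚ X ⊙ₚ (Y ·ₚ invₚ X))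
                                      [] (K ∷ M ∷ []) refl ⟩
    det M ⊙ (K · inv M)          ≡⟨ ⊙-unit (K · inv M) det≡1 ⟩
    K · inv M                    ∎)
    where open ∼-Reasoning

  ⇄-resp-∼ : ∀ {K M N} → M ∼ N → K ⇄ M → K ⇄ N
  ⇄-resp-∼ (inj₁ refl) KM = KM
  ⇄-resp-∼ {K} {N = N} (inj₂ refl) KM = neg-cancel (subst₂ _∼_ (·-neg K N) (neg-· N K) KM)

  ⇄-generated : ∀ {K R S} → Generate R S → InSL R → InSL S → K ⇄ R → K ⇄ S → ∀ M → InSL M → K ⇄ M
  ⇄-generated {K} {R} {S} generate R∈SL S∈SL KR KS M M∈SL =
    let _ , letters , M∼w = generate M M∈SL in ⇄-resp-∼ (∼-sym M∼w) (⇄-word letters)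
    where
    ⇄-letter : ∀ {x} → x ≡ R ⊎ x ≡ S ⊎ x ≡ inv R ⊎ x ≡ inv S → K ⇄ x
    ⇄-letter (inj₁ refl)               = KR
    ⇄-letter (inj₂ (inj₁ refl))        = KS
    ⇄-letter (inj₂ (inj₂ (inj₁ refl))) = ⇄-inv R∈SL KR
    ⇄-letter (inj₂ (inj₂ (inj₂ refl))) = ⇄-inv S∈SL KS
    ⇄-word : ∀ {w} → All (λ x → x ≡ R ⊎ x ≡ S ⊎ x ≡ inv R ⊎ x ≡ inv S) w → K ⇄ eval w
    ⇄-word []       = ⇄-I K
    ⇄-word (x ∷ xs) = ⇄-· (⇄-letter x) (⇄-word xs)

  transpose-· : ∀ M N → transpose (M · N) ≡ transpose N · transpose M
  transpose-· M N = matrix-identity 0 2 (λ X Y → transposeₚ (X ·ₚ Y) , transposeₚ Y ·ₚ transposeₚ X)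
                      [] (M ∷ N ∷ []) refl

  ⇄-transpose : ∀ {K M} → K ⇄ M → transpose K ⇄ transpose M
  ⇄-transpose {K} {M} = ∼-sym ∘ subst₂ _∼_ (transpose-· K M) (transpose-· M K) ∘ transpose-cong
    where
    transpose-cong : ∀ {X Y} → X ∼ Y → transpose X ∼ transpose Y
    transpose-cong (inj₁ refl) = ∼-refl
    transpose-cong (inj₂ refl) = inj₂ refl

  ⇄-U : ∀ {K} → K ⇄ U → c K ≡ 0# × a K ≡ d K
  ⇄-U {K} (inj₁ KU≡UK) = c≡0 , x∙y⁻¹≈ε⇒x≈y _ _ a-d≡0
    where
    open ≡-Reasoning
    Z≡O : K · U ⊖ U · K ≡ O
    Z≡O = trans (cong (_⊖ U · K) KU≡UK) (⊖-self (U · K))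
    c≡0 : c K ≡ 0#
    c≡0 = begin
      c K                  ≡⟨ scalar-identity 0 1 (λ X → cₚ X , :- aₚ (X ·ₚ Uₚ ⊖ₚ Uₚ ·ₚ X)) [] (K ∷ []) refl ⟩
      - a (K · U ⊖ U · K)  ≡⟨ cong (λ Z → - a Z) Z≡O ⟩
      - 0#                 ≡⟨ -0#≈0# ⟩
      0#                   ∎
    a-d≡0 : a K - d K ≡ 0#
    a-d≡0 = begin
      a K - d K            ≡⟨ scalar-identity 0 1 (λ X → aₚ X :- dₚ X , bₚ (X ·ₚ Uₚ ⊖ₚ Uₚ ·ₚ X)) [] (K ∷ []) refl ⟩
      b (K · U ⊖ U · K)    ≡⟨ cong b Z≡O ⟩
      0#                   ∎
  -- Here 2c = 0 and 2(a - d) = 0; showing that c and a - d square to 0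
  -- instead avoids splitting on the characteristic.
  ⇄-U {K} (inj₂ KU≡-UK) = square≡0⇒≡0 c²≡0 , x∙y⁻¹≈ε⇒x≈y _ _ (square≡0⇒≡0 [a-d]²≡0)
    where
    open ≡-Reasoning
    Z = K · U ⊕ U · K
    Zₚ : ∀ {n} → Matₚ n → Matₚ n
    Zₚ X = X ·ₚ Uₚ ⊕ₚ Uₚ ·ₚ X
    Z≡O : Z ≡ O
    Z≡O = trans (cong (_⊕ U · K) KU≡-UK) (neg-⊕-self (U · K))
    c²≡0 : c K * c K ≡ 0#
    c²≡0 = begin
      c K * c K              ≡⟨ scalar-identity 0 1 (λ X → cₚ X :* cₚ X , cₚ X :* aₚ (Zₚ X) :- aₚ X :* cₚ (Zₚ X))
                                  [] (K ∷ []) refl ⟩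
      c K * a Z - a K * c Z  ≡⟨ cong (λ Y → c K * a Y - a K * c Y) Z≡O ⟩
      c K * 0# - a K * 0#    ≡⟨ solve 2 (λ x y → x :* con (+ 0) :- y :* con (+ 0) := con (+ 0)) refl (c K) (a K) ⟩
      0#                     ∎
    [a-d]²≡0 : (a K - d K) * (a K - d K) ≡ 0#
    [a-d]²≡0 = begin
      (a K - d K) * (a K - d K)
        ≡⟨ scalar-identity 0 1 (λ X → (aₚ X :- dₚ X) :* (aₚ X :- dₚ X) ,
                                      (aₚ X :- dₚ X) :* bₚ (Zₚ X) :- (bₚ X :+ dₚ X) :* (aₚ (Zₚ X) :- dₚ (Zₚ X)))
             [] (K ∷ []) refl ⟩
      (a K - d K) * b Z - (b K + d K) * (a Z - d Z)
        ≡⟨ cong (λ Y → (a K - d K) * b Y - (b K + d K) * (a Y - d Y)) Z≡O ⟩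
      (a K - d K) * 0# - (b K + d K) * (0# - 0#)
        ≡⟨ solve 2 (λ x y → x :* con (+ 0) :- y :* (con (+ 0) :- con (+ 0)) := con (+ 0)) refl (a K - d K) (b K + d K) ⟩
      0#
        ∎

  ⇄-U-L⇒IsScalar : ∀ {K} → K ⇄ U → K ⇄ L → IsScalar K
  ⇄-U-L⇒IsScalar KU KL = proj₁ (⇄-U (⇄-transpose KL)) , ⇄-U KU

  quotient-⇄ : ∀ {g X Y} → det g ≡ 1# → g · Y · inv g ∼ inv Y → Inverts X Y → inv g · X ⇄ Y
  quotient-⇄ {g} {X} {Y} det≡1 gYg⁻¹∼Y⁻¹ XY = begin
    inv g · X · Y        ≡⟨ ·-assoc (inv g) X Y ⟩
    inv g · (X · Y)      ≡⟨ cong (inv g ·_) XY ⟩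
    inv g · (inv Y · X)  ≡⟨ ·-assoc (inv g) (inv Y) X ⟨
    inv g · inv Y · X    ≈⟨ ∼-·ʳ X g⁻¹Y⁻¹∼Yg⁻¹ ⟩
    Y · inv g · X        ≡⟨ ·-assoc Y (inv g) X ⟩
    Y · (inv g · X)      ∎
    where
    open ∼-Reasoning
    g⁻¹Y⁻¹∼Yg⁻¹ : inv g · inv Y ∼ Y · inv g
    g⁻¹Y⁻¹∼Yg⁻¹ = begin
      inv g · inv Y            ≈⟨ ∼-·ˡ (inv g) gYg⁻¹∼Y⁻¹ ⟨
      inv g · (g · Y · inv g)  ≡⟨ matrix-identity 0 2 (λ G Z → invₚ G ·ₚ (G ·ₚ Z ·ₚ invₚ G) , detₚ G ⊙ₚ (Z ·ₚ invₚ G))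
                                    [] (g ∷ Y ∷ []) refl ⟩
      det g ⊙ (Y · inv g)      ≡⟨ ⊙-unit (Y · inv g) det≡1 ⟩
      Y · inv g                ∎

  -- Cayley–Hamilton in the form R + inv R = tr R ⊙ I is what makes the
  -- bracket intertwine R with its inverse.
  bracket-inverts-left : ∀ R S → Inverts (bracket R S) R
  bracket-inverts-left R S = matrix-identity 0 2
    (λ X Y → bracketₚ X Y ·ₚ X , invₚ X ·ₚ bracketₚ X Y) [] (R ∷ S ∷ []) refl

  bracket-inverts-right : ∀ R S → Inverts (bracket R S) S
  bracket-inverts-right R S = matrix-identity 0 2
    (λ X Y → bracketₚ X Y ·ₚ Y , invₚ Y ·ₚ bracketₚ X Y) [] (R ∷ S ∷ []) refl

  det-bracket : ∀ R S → det (bracket R S) ≡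
    (1# + 1# + 1# + 1#) * det R * det S - det S * (tr R * tr R) - det R * (tr S * tr S)
      - tr (R · S) * tr (R · S) + tr R * tr S * tr (R · S)
  det-bracket R S = scalar-identity 0 2
    (λ X Y → detₚ (bracketₚ X Y) ,
             con (+ 4) :* detₚ X :* detₚ Y :- detₚ Y :* (trₚ X :* trₚ X) :- detₚ X :* (trₚ Y :* trₚ Y)
               :- trₚ (X ·ₚ Y) :* trₚ (X ·ₚ Y) :+ trₚ X :* trₚ Y :* trₚ (X ·ₚ Y))
    [] (R ∷ S ∷ []) refl

  bracket-fullyRegular : ∀ {R S} → ¬ det (bracket R S) ≡ 0# → FullyRegular R S
  bracket-fullyRegular {R} {S} D≢0 =
    conjugate (bracket R S) κ , reflection κD≡1 (bracket-inverts-left R S) (bracket-inverts-right R S)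
    where
    κ = proj₁ (*-inv _ D≢0)
    κD≡1 = proj₂ (*-inv _ D≢0)

  square⇒innerRegular : ∀ {R S} → ¬ det (bracket R S) ≡ 0# → IsSquare (det (bracket R S)) → InnerRegular R S
  square⇒innerRegular {R} {S} D≢0 (y , y²≡D) =
    conjugate h 1# ,
    reflection (trans (*-identityˡ _) h∈SL) (Inverts-⊙ l (bracket-inverts-left R S)) (Inverts-⊙ l (bracket-inverts-right R S)) ,
    h , h∈SL , λ _ _ → inj₁ (⊙-identity _)
    where
    y≢0 : ¬ y ≡ 0#
    y≢0 y≡0 = D≢0 (trans (sym y²≡D) (trans (cong (λ z → z * z) y≡0) (zeroʳ 0#)))
    l = proj₁ (*-inv y y≢0)
    ly≡1 = proj₂ (*-inv y y≢0)
    h = l ⊙ bracket R S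
    h∈SL : det h ≡ 1#
    h∈SL = begin
      det (l ⊙ bracket R S)      ≡⟨ det-⊙ l (bracket R S) ⟩
      l * l * det (bracket R S)  ≡⟨ cong (l * l *_) y²≡D ⟨
      l * l * (y * y)            ≡⟨ solve 2 (λ l y → l :* l :* (y :* y) := l :* y :* (l :* y)) refl l y ⟩
      l * y * (l * y)            ≡⟨ cong (λ u → u * u) ly≡1 ⟩
      1# * 1#                    ≡⟨ *-identityˡ 1# ⟩
      1#                         ∎
      where open ≡-Reasoning

  innerRegular⇒square : ∀ {R S} → InSL R → InSL S → Generate R S → InnerRegular R S → IsSquare (det (bracket R S))
  innerRegular⇒square {R} {S} R∈SL S∈SL generate (f , (_ , fR∼R⁻¹ , fS∼S⁻¹) , g , g∈SL , f∼conj) = a K , (begin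
    a K * a K                   ≡⟨ det-IsScalar K-scalar ⟨
    det (inv g · X)             ≡⟨ det-· (inv g) X ⟩
    det (inv g) * det X         ≡⟨ cong (_* det X) (trans (det-inv g) g∈SL) ⟩
    1# * det X                  ≡⟨ *-identityˡ (det X) ⟩
    det X                       ∎)
    where
    open ≡-Reasoning
    X = bracket R S
    K = inv g · X
    K⇄R : K ⇄ R
    K⇄R = quotient-⇄ g∈SL (∼-trans (∼-sym (f∼conj R R∈SL)) fR∼R⁻¹) (bracket-inverts-left R S)
    K⇄S : K ⇄ S
    K⇄S = quotient-⇄ g∈SL (∼-trans (∼-sym (f∼conj S S∈SL)) fS∼S⁻¹) (bracket-inverts-right R S)
    K-scalar : IsScalar K
    K-scalar = ⇄-U-L⇒IsScalar (⇄-generated generate R∈SL S∈SL K⇄R K⇄S U det-U)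
                               (⇄-generated generate R∈SL S∈SL K⇄R K⇄S L det-L)

  module MapOfType3 {n R S} (7≤n : 7 ≤ n) (isMap : IsMapOfType3 n R S) where
    open IsMapOfType3 isMap

    RS∈SL : InSL (R · S)
    RS∈SL = trans (det-· R S) (trans (cong₂ _*_ R-SL S-SL) (*-identityˡ 1#))

    det-bracket≡3-t² : det (bracket R S) ≡ 3# - tr R * tr R
    det-bracket≡3-t² = begin
      det (bracket R S)
        ≡⟨ det-bracket R S ⟩
      4# * det R * det S - det S * (t * t) - det R * (tr S * tr S) - x * x + t * tr S * x
        ≡⟨ cong₂ (λ δ σ → 4# * δ * σ - σ * (t * t) - δ * (tr S * tr S) - x * x + t * tr S * x) R-SL S-SL ⟩
      4# * 1# * 1# - 1# * (t * t) - 1# * (tr S * tr S) - x * x + t * tr S * x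
        ≡⟨ cong₂ (λ τ ξ → 4# * 1# * 1# - 1# * (t * t) - 1# * (τ * τ) - ξ + t * τ * x)
                 (order-2⇒traceless S-SL S-ord) (order-3⇒trace²≡1 RS∈SL RS-ord) ⟩
      4# * 1# * 1# - 1# * (t * t) - 1# * (0# * 0#) - 1# + t * 0# * x
        ≡⟨ solve 2 (λ t x → con (+ 4) :* con (+ 1) :* con (+ 1) :- con (+ 1) :* (t :* t)
                             :- con (+ 1) :* (con (+ 0) :* con (+ 0)) :- con (+ 1) :+ t :* con (+ 0) :* x
                             := con (+ 3) :- t :* t) refl t x ⟩
      3# - t * t
        ∎
      where
      open ≡-Reasoning
      t = tr R
      x = tr (R · S)
      4# = 1# + 1# + 1# + 1#

    det-bracket≢0 : ¬ det (bracket R S) ≡ 0#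
    det-bracket≢0 D≡0 = proj₂ R-ord 6 z<s 7≤n (trace²≡3⇒^6∼I R-SL t²≡3)
      where
      t²≡3 : tr R * tr R ≡ 3#
      t²≡3 = sym (x∙y⁻¹≈ε⇒x≈y _ _ (trans (sym det-bracket≡3-t²) D≡0))

theorem1p5 : (q : ℕ) (F : FiniteField q) (n : ℕ) → 7 ≤ n → Coprime q n →
    (R S : Matrices.Mat F) → Matrices.IsMapOfType3 F n R S →
    let open FiniteField F
        t = Matrices.tr F R
    in (IsSquare (3# - t * t) → Matrices.InnerRegular F R S)
       × (¬ IsSquare (3# - t * t) → Matrices.OuterRegular F R S)
theorem1p5 q F n 7≤n _ R S isMap =
  (λ square → square⇒innerRegular det-bracket≢0 (subst IsSquare (sym det-bracket≡3-t²) square)) ,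
  (λ ¬square → bracket-fullyRegular det-bracket≢0 ,
               λ inner → ¬square (subst IsSquare det-bracket≡3-t² (innerRegular⇒square R-SL S-SL gen inner)))
  where
  open FiniteField F using (IsSquare)
  open PSL₂ F
  open MapOfType3 7≤n isMap
  open Matrices.IsMapOfType3 isMap using (R-SL; S-SL; gen)
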